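{- Let $(M, \mathcal G)$ be a general model, let $X \in \mathcal G$ and let $\phi$ be an independence logic formula over the signature of $M$ with $\mathrm{Free}(\phi) = \bar z \subseteq \mathrm{Dom}(X)$. Then $(M, \mathcal G) \models_X \phi$ if and only if $(M, \mathcal G) \models_{X_{|\bar z}} \phi$, where $X_{|\bar z}=\{s_{|\bar z}:s\in X\}$.
   Context: A team over $M$ with domain $V$ (finite) is a set of assignments $V\to\mathrm{Dom}(M)$. $\mathrm{Rel}(X)=\{s(\bar z):s\in X\}$. A general model $(M,\mathcal G)$ is a first-order structure $M$ together with a set $\mathcal G$ of teams over finite domains. It is required that for every first-order formula $\phi(x_1\ldots x_n,\bar m,\bar R)$ with element parameters $\bar m$ and relation parameters $R_i=\mathrm{Rel}(X_i)$, $X_i\in\mathcal G$, the team $\|\phi\|_M=\{s:\mathrm{Dom}(s)=\{x_1\ldots x_n\},M\models_s\phi\}$ belongs to $\mathcal G$. Independence logic formulas are in negation normal form, built from first-order literals, independence atoms $\bar t_2\perp_{\bar t_1}\bar t_3$, $\wedge,\vee,\exists,\forall$. For $X\in\mathcal G$, $(M,\mathcal G)\models_X\phi$ is defined by: - literal: each $s\in X$ satisfies it; - $\bar t_2\perp_{\bar t_1}\bar t_3$: for all $s,s'\in X$ with $\bar t_1\langle s\rangle=\bar t_1\langle s'\rangle$ there is $s''\in X$ with $\bar t_1\bar t_2\langle s''\rangle=\bar t_1\bar t_2\langle s\rangle$ and $\bar t_1\bar t_3\langle s''\rangle=\bar t_1\bar t_3\langle s'\rangle$; - $\psi_1\vee\psi_2$: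 $X=Y\cup Z$ for some $Y,Z\in\mathcal G$ with $(M,\mathcal G)\models_Y\psi_1$ and $(M,\mathcal G)\models_Z\psi_2$; - $\psi_1\wedge\psi_2$: both hold in $X$; - $\exists x\psi$: there is $X'\in\mathcal G$ with $\mathrm{Dom}(X')=\mathrm{Dom}(X)\cup\{x\}$, whose restriction to $\mathrm{Dom}(X)\setminus\{x\}$ equals that of $X$, such that $(M,\mathcal G)\models_{X'}\psi$; - $\forall x\psi$: $(M,\mathcal G)\models_{X[M/x]}\psi$ with $X[M/x]=\{s[m/x]:s\in X,m\in\mathrm{Dom}(M)\}$. -}

module Defs where

open import Data.Nat using (ℕ; _≡ᵇ_)
open import Data.Bool using (Bool; true; false; if_then_else_)
open import Data.Empty using (⊥; ⊥-elim)
open import Data.List using (List; []; _∷_; _++_; map)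
open import Data.List.Membership.Propositional using (_∈_)
open import Data.Vec using (Vec; []; _∷_)
open import Data.Product using (Σ; _×_; _,_)
open import Data.Sum using (_⊎_)
open import Relation.Nullary using (¬_)
open import Relation.Binary.PropositionalEquality using (_≡_)
open import Function.Bundles using (_⇔_)
import Level

Up : Set → Set₁
Up A = Level.Lift (Level.suc Level.zero) A

record Signature : Set₁ where
  field
    Fun  : Set
    fAr  : Fun → ℕ
    Rel  : Set
    rAr  : Rel → ℕ

record Structure (σ : Signature) : Set₁ where
  open Signature σ
  field
    D    : Set
    fun  : (f : Fun) → Vec D (fAr f) → D
    rel  : (R : Rel) → Vec D (rAr R) → Set

-- Variables are natural numbers. Terms may contain parameters from P
-- (P = ⊥ for plain terms of the signature, P = Dom(M) for element parameters).
data Term (σ : Signature) (P : Set) : Set where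
  var : ℕ → Term σ P
  par : P → Term σ P
  app : (f : Signature.Fun σ) → Vec (Term σ P) (Signature.fAr σ f) → Term σ P

module _ {σ : Signature} {P : Set} where
  mutual
    fvT : Term σ P → List ℕ
    fvT (var x) = x ∷ []
    fvT (par _) = []
    fvT (app f ts) = fvTs ts

    fvTs : ∀ {n} → Vec (Term σ P) n → List ℕ
    fvTs [] = []
    fvTs (t ∷ ts) = fvT t ++ fvTs ts

  fvTL : List (Term σ P) → List ℕ
  fvTL [] = []
  fvTL (t ∷ ts) = fvT t ++ fvTL ts

remove : ℕ → List ℕ → List ℕ
remove x [] = []
remove x (y ∷ ys) = if y ≡ᵇ x then remove x ys else y ∷ remove x ys

update : {D : Set} → (ℕ → D) → ℕ → D → (ℕ → D)
update s x d y = if y ≡ᵇ x then d else s y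

module _ {σ : Signature} (M : Structure σ) where
  open Structure M

  module _ {P : Set} (ι : P → D) (s : ℕ → D) where
    mutual
      evalT : Term σ P → D
      evalT (var x) = s x
      evalT (par p) = ι p
      evalT (app f ts) = fun f (evalTs ts)

      evalTs : ∀ {n} → Vec (Term σ P) n → Vec D n
      evalTs [] = []
      evalTs (t ∷ ts) = evalT t ∷ evalTs ts

    evalTL : List (Term σ P) → List D
    evalTL ts = map evalT ts

agree : {D : Set} → List ℕ → (ℕ → D) → (ℕ → D) → Set
agree V s s' = ∀ x → x ∈ V → s x ≡ s' x

-- An assignment V → D is represented by a
-- total function ℕ → D whose values outside V are irrelevant; the team is the
-- set of restrictions to `dom` of the functions satisfying `mem`.
record Team (D : Set) : Set₁ where
  field
    dom : List ℕ
    mem : (ℕ → D) → Set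
open Team public

_∈T_ : {D : Set} → (ℕ → D) → Team D → Set
s ∈T X = Σ _ λ s' → mem X s' × agree (dom X) s' s

sameDom : List ℕ → List ℕ → Set
sameDom V W = ∀ x → (x ∈ V) ⇔ (x ∈ W)

_≐_ : {D : Set} → Team D → Team D → Set
X ≐ Y = sameDom (dom X) (dom Y) × (∀ s → (s ∈T X) ⇔ (s ∈T Y))

_↾_ : {D : Set} → Team D → List ℕ → Team D
X ↾ W = record { dom = W ; mem = λ s → s ∈T X }

dup : {D : Set} → Team D → ℕ → Team D
dup {D} X x = record
  { dom = x ∷ dom X
  ; mem = λ s → Σ (ℕ → D) λ s₀ → s₀ ∈T X × Σ D λ m → ∀ y → s y ≡ update s₀ x m y }

-- First-order formulas with element parameters (P) and relation
-- parameters given by teams indexed by I (atom R_i(t̄) means t̄ ∈ Rel(X_i),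
-- Rel(X_i) = { s(z̄) : s ∈ X_i } with z̄ the list dom X_i).

data FO (σ : Signature) (P I : Set) : Set where
  eqF   : Term σ P → Term σ P → FO σ P I
  relF  : (R : Signature.Rel σ) → Vec (Term σ P) (Signature.rAr σ R) → FO σ P I
  rparF : I → List (Term σ P) → FO σ P I
  negF  : FO σ P I → FO σ P I
  andF  : FO σ P I → FO σ P I → FO σ P I
  orF   : FO σ P I → FO σ P I → FO σ P I
  exF   : ℕ → FO σ P I → FO σ P I
  allF  : ℕ → FO σ P I → FO σ P I

fvFO : ∀ {σ P I} → FO σ P I → List ℕ
fvFO (eqF t u) = fvT t ++ fvT u
fvFO (relF R ts) = fvTs ts
fvFO (rparF i ts) = fvTL ts
fvFO (negF φ) = fvFO φ
fvFO (andF φ ψ) = fvFO φ ++ fvFO ψ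
fvFO (orF φ ψ) = fvFO φ ++ fvFO ψ
fvFO (exF x φ) = remove x (fvFO φ)
fvFO (allF x φ) = remove x (fvFO φ)

module _ {σ : Signature} (M : Structure σ) {I : Set}
         (T : I → Team (Structure.D M)) where
  open Structure M

  FOsat : (ℕ → D) → FO σ D I → Set
  FOsat s (eqF t u) = evalT M (λ d → d) s t ≡ evalT M (λ d → d) s u
  FOsat s (relF R ts) = rel R (evalTs M (λ d → d) s ts)
  FOsat s (rparF i ts) =
    Σ (ℕ → D) λ s' → s' ∈T T i × map s' (dom (T i)) ≡ evalTL M (λ d → d) s ts
  FOsat s (negF φ) = ¬ FOsat s φ
  FOsat s (andF φ ψ) = FOsat s φ × FOsat s ψ
  FOsat s (orF φ ψ) = FOsat s φ ⊎ FOsat s ψ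
  FOsat s (exF x φ) = Σ D λ d → FOsat (update s x d) φ
  FOsat s (allF x φ) = ∀ d → FOsat (update s x d) φ

  ⟦_⟧_ : FO σ D I → List ℕ → Team D
  ⟦ φ ⟧ xs = record { dom = xs ; mem = λ s → FOsat s φ }

record GeneralModel {σ : Signature} (M : Structure σ) : Set₁ where
  open Structure M
  field
    Idx  : Set
    team : Idx → Team D
  _∈G : Team D → Set
  X ∈G = Σ Idx λ i → team i ≐ X
  field
    closed : (φ : FO σ D Idx) (xs : List ℕ) →
             (∀ x → x ∈ fvFO φ → x ∈ xs) →
             (⟦_⟧_ M team φ xs) ∈G
open GeneralModel public

-- Independence logic (negation normal form)

data IL (σ : Signature) : Set where
  eqL    : Term σ ⊥ → Term σ ⊥ → IL σ
  neqL   : Term σ ⊥ → Term σ ⊥ → IL σ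
  relL   : (R : Signature.Rel σ) → Vec (Term σ ⊥) (Signature.rAr σ R) → IL σ
  nrelL  : (R : Signature.Rel σ) → Vec (Term σ ⊥) (Signature.rAr σ R) → IL σ
  -- indep t₁ t₂ t₃  is  t̄₂ ⊥_{t̄₁} t̄₃
  indep  : List (Term σ ⊥) → List (Term σ ⊥) → List (Term σ ⊥) → IL σ
  andL   : IL σ → IL σ → IL σ
  orL    : IL σ → IL σ → IL σ
  exL    : ℕ → IL σ → IL σ
  allL   : ℕ → IL σ → IL σ

Free : ∀ {σ} → IL σ → List ℕ
Free (eqL t u) = fvT t ++ fvT u
Free (neqL t u) = fvT t ++ fvT u
Free (relL R ts) = fvTs ts
Free (nrelL R ts) = fvTs ts
Free (indep t₁ t₂ t₃) = fvTL t₁ ++ fvTL t₂ ++ fvTL t₃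
Free (andL φ ψ) = Free φ ++ Free ψ
Free (orL φ ψ) = Free φ ++ Free ψ
Free (exL x φ) = remove x (Free φ)
Free (allL x φ) = remove x (Free φ)

module _ {σ : Signature} {M : Structure σ} (G : GeneralModel M) where
  open Structure M

  private
    ev : (ℕ → D) → Term σ ⊥ → D
    ev s t = evalT M ⊥-elim s t
    evs : (ℕ → D) → List (Term σ ⊥) → List D
    evs s ts = evalTL M ⊥-elim s ts
    evv : ∀ {n} → (ℕ → D) → Vec (Term σ ⊥) n → Vec D n
    evv s ts = evalTs M ⊥-elim s ts

  Sat : Team D → IL σ → Set₁
  Sat X (eqL t u)   = ∀ s → s ∈T X → Up (ev s t ≡ ev s u)
  Sat X (neqL t u)  = ∀ s → s ∈T X → Up (¬ ev s t ≡ ev s u)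
  Sat X (relL R ts) = ∀ s → s ∈T X → Up (rel R (evv s ts))
  Sat X (nrelL R ts) = ∀ s → s ∈T X → Up (¬ rel R (evv s ts))
  Sat X (indep t₁ t₂ t₃) =
    ∀ s s' → s ∈T X → s' ∈T X → evs s t₁ ≡ evs s' t₁ →
      Up (Σ (ℕ → D) λ s'' → s'' ∈T X ×
             evs s'' (t₁ ++ t₂) ≡ evs s (t₁ ++ t₂) ×
             evs s'' (t₁ ++ t₃) ≡ evs s' (t₁ ++ t₃))
  Sat X (andL φ ψ) = Sat X φ × Sat X ψ
  Sat X (orL φ ψ) =
    Σ (Team D) λ Y → Σ (Team D) λ Z →
      ((G ∈G) Y × (G ∈G) Z) ×
      (sameDom (dom Y) (dom X) × sameDom (dom Z) (dom X) ×
       (∀ s → (s ∈T X) ⇔ ((s ∈T Y) ⊎ (s ∈T Z)))) ×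
      Sat Y φ × Sat Z ψ
  Sat X (exL x φ) =
    Σ (Team D) λ X' →
      (G ∈G) X' ×
      sameDom (dom X') (x ∷ dom X) ×
      ((X' ↾ remove x (dom X)) ≐ (X ↾ remove x (dom X))) ×
      Sat X' φ
  Sat X (allL x φ) = Sat (dup X x) φ

module Submission where

-- Call two teams X, Y "V-similar" (X ≈[ V ] Y) when V lies in
-- both domains and every assignment of either team agrees on V with some
-- assignment of the other; X and X ↾ V are V-similar.  The transfer lemma
-- says: if Free φ ⊆ V, X ≈[ V ] Y and Y ∈ 𝒢, then X ⊨ φ implies Y ⊨ φ.  Literals and independence atoms only inspect
-- values on V.  For ∨ and ∃ the witnessing teams for X must be mirrored by
-- teams on the Y side, and these must again lie in 𝒢; this is where the
-- closure of 𝒢 under first-order definability is used.  The key formula is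
-- agreesWith i W, which defines the assignments agreeing on W with some
-- member of the team 𝒢ᵢ (an existential quantification of the relation
-- parameter Rel(𝒢ᵢ)).  With it, X ↾ W, X[M/x] and the mirrored pieces are
-- all definable, hence in 𝒢.  The theorem is the transfer lemma applied in
-- both directions to X ≈[ Free φ ] X ↾ Free φ.

open import Defs
open import Data.Nat using (ℕ; _≡ᵇ_; _≟_)
open import Data.Nat.Properties using (≡ᵇ⇒≡; ≡⇒≡ᵇ)
open import Data.Bool using (true; false; T)
open import Data.Unit using (tt)
open import Data.Empty using (⊥; ⊥-elim)
open import Data.List using (List; []; _∷_; _++_; map; filter)
open import Data.List.Properties using (++-assoc; ∷-injective; map-cong-local)
open import Data.List.Relation.Unary.All using (tabulate)
open import Data.List.Relation.Unary.Any using (here; there)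
open import Data.List.Membership.Propositional using (_∈_; _∉_)
open import Data.List.Membership.Propositional.Properties
  using (∈-++⁺ˡ; ∈-++⁺ʳ; ∈-++⁻; ∈-filter⁺; ∈-filter⁻)
open import Data.List.Membership.DecPropositional _≟_ using (_∈?_)
open import Data.Vec using (Vec; []; _∷_)
open import Data.Product using (Σ; _×_; _,_; proj₁; proj₂)
open import Data.Sum using (_⊎_; inj₁; inj₂)
open import Relation.Nullary using (¬_; yes; no; ¬?)
open import Relation.Binary.PropositionalEquality
  using (_≡_; refl; sym; trans; cong; cong₂; subst)
open import Function.Bundles using (_⇔_; mk⇔; Equivalence)
open import Level using (lift; lower)

open Equivalence using (to; from)

_⊆_ : List ℕ → List ℕ → Set
A ⊆ B = ∀ x → x ∈ A → x ∈ B

⊆-refl : ∀ {A} → A ⊆ A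
⊆-refl _ m = m

++⊆ˡ : ∀ {A B C} → (A ++ B) ⊆ C → A ⊆ C
++⊆ˡ h z m = h z (∈-++⁺ˡ m)

++⊆ʳ : ∀ {A B C} → (A ++ B) ⊆ C → B ⊆ C
++⊆ʳ {A} h z m = h z (∈-++⁺ʳ A m)

≡ᵇ-true : ∀ {m n} → (m ≡ᵇ n) ≡ true → m ≡ n
≡ᵇ-true {m} {n} e = ≡ᵇ⇒≡ m n (subst T (sym e) tt)

≡ᵇ-false : ∀ {m n} → (m ≡ᵇ n) ≡ false → ¬ m ≡ n
≡ᵇ-false {m} e refl = subst T e (≡⇒≡ᵇ m m refl)

update-same : {D : Set} (s : ℕ → D) (x : ℕ) (d : D) → update s x d x ≡ d
update-same s x d with x ≡ᵇ x in e
... | true  = refl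
... | false = ⊥-elim (≡ᵇ-false {x} e refl)

update-other : {D : Set} (s : ℕ → D) (x : ℕ) (d : D) {y : ℕ} →
               ¬ y ≡ x → update s x d y ≡ s y
update-other s x d {y} y≢x with y ≡ᵇ x in e
... | true  = ⊥-elim (y≢x (≡ᵇ-true e))
... | false = refl

∈-remove⁻ : ∀ {z x} L → z ∈ remove x L → z ∈ L × ¬ z ≡ x
∈-remove⁻ {x = x} (y ∷ L) h with y ≡ᵇ x in e
... | true = let (m , z≢x) = ∈-remove⁻ L h in there m , z≢x
... | false with h
...   | here refl = here refl , ≡ᵇ-false e
...   | there h'  = let (m , z≢x) = ∈-remove⁻ L h' in there m , z≢x

∈-remove⁺ : ∀ {z x} L → z ∈ L → ¬ z ≡ x → z ∈ remove x L
∈-remove⁺ {x = x} (y ∷ L) h z≢x with y ≡ᵇ x in e | h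
... | true  | here refl = ⊥-elim (z≢x (≡ᵇ-true e))
... | true  | there h'  = ∈-remove⁺ L h' z≢x
... | false | here refl = here refl
... | false | there h'  = there (∈-remove⁺ L h' z≢x)

remove⊆ : ∀ x L → remove x L ⊆ L
remove⊆ x L z m = proj₁ (∈-remove⁻ L m)

remove⊆⇒⊆∷ : ∀ x L V → remove x L ⊆ V → L ⊆ (x ∷ V)
remove⊆⇒⊆∷ x L V h z m with z ≟ x
... | yes z≡x = here z≡x
... | no  z≢x = there (h z (∈-remove⁺ L m z≢x))

_∖_ : List ℕ → List ℕ → List ℕ
L ∖ W = filter (λ y → ¬? (y ∈? W)) L

∈-∖⁻ : ∀ {z} L W → z ∈ L ∖ W → z ∉ W
∈-∖⁻ L W m = proj₂ (∈-filter⁻ (λ y → ¬? (y ∈? W)) {xs = L} m)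

∈-∖⁺ : ∀ {z} L W → z ∈ L → z ∉ W → z ∈ L ∖ W
∈-∖⁺ L W = ∈-filter⁺ (λ y → ¬? (y ∈? W))

override : {D : Set} → List ℕ → (ℕ → D) → (ℕ → D) → ℕ → D
override ys r s z with z ∈? ys
... | yes _ = r z
... | no  _ = s z

override-in : {D : Set} (ys : List ℕ) (r s : ℕ → D) {z : ℕ} →
              z ∈ ys → override ys r s z ≡ r z
override-in ys r s {z} m with z ∈? ys
... | yes _ = refl
... | no ¬m = ⊥-elim (¬m m)

override-out : {D : Set} (ys : List ℕ) (r s : ℕ → D) {z : ℕ} →
               z ∉ ys → override ys r s z ≡ s z
override-out ys r s {z} ¬m with z ∈? ys
... | yes m = ⊥-elim (¬m m)
... | no  _ = refl

agree-⊆ : ∀ {D : Set} {V W : List ℕ} {s r : ℕ → D} → agree V s r → W ⊆ V → agree W s r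
agree-⊆ a W⊆V z m = a z (W⊆V z m)

agree-sym : ∀ {D : Set} {V : List ℕ} {s r : ℕ → D} → agree V s r → agree V r s
agree-sym a z m = sym (a z m)

agree⇒map≡ : {D : Set} (f g : ℕ → D) (L : List ℕ) → agree L f g → map f L ≡ map g L
agree⇒map≡ f g L a = map-cong-local (tabulate (λ {z} m → a z m))

map≡⇒agree : {D : Set} (f g : ℕ → D) (L : List ℕ) → map f L ≡ map g L → agree L f g
map≡⇒agree f g (y ∷ L) e z (here refl) = proj₁ (∷-injective e)
map≡⇒agree f g (y ∷ L) e z (there m)   = map≡⇒agree f g L (proj₂ (∷-injective e)) z m

module Eval {σ : Signature} (M : Structure σ) {P : Set} (ι : P → Structure.D M) where
  mutual
    evalT-agree : ∀ (t : Term σ P) s s' → agree (fvT t) s s' →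
                  evalT M ι s t ≡ evalT M ι s' t
    evalT-agree (var x)    s s' a = a x (here refl)
    evalT-agree (par p)    s s' a = refl
    evalT-agree (app f ts) s s' a = cong (Structure.fun M f) (evalTs-agree ts s s' a)

    evalTs-agree : ∀ {n} (ts : Vec (Term σ P) n) s s' → agree (fvTs ts) s s' →
                   evalTs M ι s ts ≡ evalTs M ι s' ts
    evalTs-agree []       s s' a = refl
    evalTs-agree (t ∷ ts) s s' a =
      cong₂ _∷_ (evalT-agree t s s' (agree-⊆ a (++⊆ˡ ⊆-refl)))
                (evalTs-agree ts s s' (agree-⊆ a (++⊆ʳ {fvT t} ⊆-refl)))

  evalTL-agree : ∀ (ts : List (Term σ P)) s s' → agree (fvTL ts) s s' →
                 evalTL M ι s ts ≡ evalTL M ι s' ts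
  evalTL-agree []       s s' a = refl
  evalTL-agree (t ∷ ts) s s' a =
    cong₂ _∷_ (evalT-agree t s s' (agree-⊆ a (++⊆ˡ ⊆-refl)))
              (evalTL-agree ts s s' (agree-⊆ a (++⊆ʳ {fvT t} ⊆-refl)))

  fvTL-++ : ∀ (ts us : List (Term σ P)) → fvTL (ts ++ us) ≡ fvTL ts ++ fvTL us
  fvTL-++ []       us = refl
  fvTL-++ (t ∷ ts) us =
    trans (cong (fvT t ++_) (fvTL-++ ts us)) (sym (++-assoc (fvT t) (fvTL ts) (fvTL us)))

  evalTL-var : ∀ s L → evalTL M ι s (map var L) ≡ map s L
  evalTL-var s []      = refl
  evalTL-var s (y ∷ L) = cong (s y ∷_) (evalTL-var s L)

  fvTL-var : ∀ L → fvTL {σ} {P} (map var L) ≡ L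
  fvTL-var []      = refl
  fvTL-var (y ∷ L) = cong (y ∷_) (fvTL-var L)

module Locality {σ : Signature} (M : Structure σ) (G : GeneralModel M) where
  open Structure M
  open Eval M {⊥} ⊥-elim using (evalT-agree; evalTs-agree; evalTL-agree; fvTL-++)
  open Eval M {D} (λ d → d) using (evalTL-var; fvTL-var)

  Formula : Set
  Formula = FO σ D (Idx G)

  sat : (ℕ → D) → Formula → Set
  sat = FOsat M (team G)

  ∈T-agree : ∀ (X : Team D) {s t} → s ∈T X → agree (dom X) s t → t ∈T X
  ∈T-agree X (s' , m , a) e = s' , m , λ z h → trans (a z h) (e z h)

  ≐-trans : {A B C : Team D} → A ≐ B → B ≐ C → A ≐ C
  ≐-trans (d₁ , e₁) (d₂ , e₂) =
    (λ x → mk⇔ (λ m → to (d₂ x) (to (d₁ x) m)) (λ m → from (d₁ x) (from (d₂ x) m))) ,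
    (λ s → mk⇔ (λ m → to (e₂ s) (to (e₁ s) m)) (λ m → from (e₁ s) (from (e₂ s) m)))

  ∈G-resp : {A B : Team D} → (G ∈G) A → A ≐ B → (G ∈G) B
  ∈G-resp (i , e) e' = i , ≐-trans e e'

  definable∈G : (ψ : Formula) (B : Team D) → fvFO ψ ⊆ dom B →
                (∀ s → sat s ψ → s ∈T B) → (∀ s → s ∈T B → sat s ψ) → (G ∈G) B
  definable∈G ψ B fv sound complete =
    ∈G-resp (closed G ψ (dom B) fv)
      ((λ x → mk⇔ (λ m → m) (λ m → m)) ,
       (λ s → mk⇔ (λ { (s' , h , a) → ∈T-agree B (sound s' h) a })
                  (λ m → s , complete s m , (λ _ _ → refl))))

  ∃* : List ℕ → Formula → Formula
  ∃* []       ψ = ψ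
  ∃* (y ∷ ys) ψ = exF y (∃* ys ψ)

  ∃*-sound : ∀ ys ψ s → sat s (∃* ys ψ) →
             Σ (ℕ → D) λ s₁ → (∀ z → z ∉ ys → s₁ z ≡ s z) × sat s₁ ψ
  ∃*-sound []       ψ s h = s , (λ _ _ → refl) , h
  ∃*-sound (y ∷ ys) ψ s (d , h) with ∃*-sound ys ψ (update s y d) h
  ... | s₁ , a , h₁ = s₁ , outside , h₁
    where
    outside : ∀ z → z ∉ y ∷ ys → s₁ z ≡ s z
    outside z z∉ = trans (a z (λ m → z∉ (there m))) (update-other s y d (λ e → z∉ (here e)))

  -- Completeness needs ψ to be invariant under pointwise equal assignments
  -- (assignments are functions and we do not assume extensionality).
  ∃*-complete : ∀ ys ψ → (∀ s s₁ → (∀ z → s₁ z ≡ s z) → sat s₁ ψ → sat s ψ) →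
                ∀ s s₁ → (∀ z → z ∉ ys → s₁ z ≡ s z) → sat s₁ ψ → sat s (∃* ys ψ)
  ∃*-complete []       ψ ext s s₁ a h = ext s s₁ (λ z → a z (λ ())) h
  ∃*-complete (y ∷ ys) ψ ext s s₁ a h =
    s₁ y , ∃*-complete ys ψ ext (update s y (s₁ y)) s₁ outside h
    where
    outside : ∀ z → z ∉ ys → s₁ z ≡ update s y (s₁ y) z
    outside z z∉ with z ≟ y
    ... | yes refl = sym (update-same s y (s₁ y))
    ... | no  z≢y  = trans (a z λ { (here e) → z≢y e ; (there m) → z∉ m })
                           (sym (update-other s y (s₁ y) z≢y))

  fv-∃* : ∀ ys ψ z → z ∈ fvFO (∃* ys ψ) → z ∈ fvFO ψ × z ∉ ys
  fv-∃* []       ψ z m = m , λ ()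
  fv-∃* (y ∷ ys) ψ z m with ∈-remove⁻ (fvFO (∃* ys ψ)) m
  ... | m' , z≢y with fv-∃* ys ψ z m'
  ...   | m'' , z∉ = m'' , λ { (here e) → z≢y e ; (there k) → z∉ k }

  inTeam : Idx G → Formula
  inTeam i = rparF i (map var (dom (team G i)))

  inTeam-ext : ∀ i s s₁ → (∀ z → s₁ z ≡ s z) → sat s₁ (inTeam i) → sat s (inTeam i)
  inTeam-ext i s s₁ a (r , r∈ , e) =
    r , r∈ , trans e (trans (evalTL-var s₁ L)
                     (trans (agree⇒map≡ s₁ s L (λ z _ → a z)) (sym (evalTL-var s L))))
    where
    L : List ℕ
    L = dom (team G i)

  agreesWith : Idx G → List ℕ → Formula
  agreesWith i W = ∃* (dom (team G i) ∖ W) (inTeam i)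

  fv-agreesWith : ∀ i W → fvFO (agreesWith i W) ⊆ W
  fv-agreesWith i W z m with fv-∃* (dom (team G i) ∖ W) (inTeam i) z m
  ... | m₁ , z∉ with z ∈? W
  ...   | yes z∈W = z∈W
  ...   | no  z∉W = ⊥-elim (z∉ (∈-∖⁺ L W (subst (z ∈_) (fvTL-var L) m₁) z∉W))
    where
    L : List ℕ
    L = dom (team G i)

  agreesWith-sound : ∀ {i} {B : Team D} W s → team G i ≐ B → W ⊆ dom B →
                     sat s (agreesWith i W) → Σ (ℕ → D) λ r → r ∈T B × agree W r s
  agreesWith-sound {i} W s (d , e) W⊆B h
    with ∃*-sound (dom (team G i) ∖ W) (inTeam i) s h
  ... | s₁ , a , (r , r∈ , r≡s₁) = r , to (e r) r∈ , agreeOnW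
    where
    L : List ℕ
    L = dom (team G i)
    agreeOnW : agree W r s
    agreeOnW z m =
      trans (map≡⇒agree r s₁ L (trans r≡s₁ (evalTL-var s₁ L)) z (from (d z) (W⊆B z m)))
            (a z (λ k → ∈-∖⁻ L W k m))

  agreesWith-complete : ∀ {i} {B : Team D} W {s r} → team G i ≐ B → r ∈T B →
                        agree W r s → sat s (agreesWith i W)
  agreesWith-complete {i} W {s} {r} (_ , e) r∈ a =
    ∃*-complete ys (inTeam i) (inTeam-ext i) s s₁ (λ z z∉ → override-out ys r s z∉)
      (r , from (e r) r∈ , trans (agree⇒map≡ r s₁ L r≡s₁) (sym (evalTL-var s₁ L)))
    where
    L ys : List ℕ
    L  = dom (team G i)
    ys = L ∖ W
    s₁ : ℕ → D
    s₁ = override ys r s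
    r≡s₁ : agree L r s₁
    r≡s₁ z m with z ∈? W
    ... | yes z∈W = trans (a z z∈W) (sym (override-out ys r s (λ k → ∈-∖⁻ L W k z∈W)))
    ... | no  z∉W = sym (override-in ys r s (∈-∖⁺ L W m z∉W))

  restrict∈G : ∀ (X : Team D) W → (G ∈G) X → W ⊆ dom X → (G ∈G) (X ↾ W)
  restrict∈G X W (i , e) W⊆X =
    definable∈G (agreesWith i W) (X ↾ W) (fv-agreesWith i W)
      (λ s h → agreesWith-sound W s e W⊆X h)
      (λ { s (s' , s'∈ , a) → agreesWith-complete W e s'∈ a })

  dup∈G : ∀ (Y : Team D) x → (G ∈G) Y → (G ∈G) (dup Y x)
  dup∈G Y x (i , e) =
    definable∈G (agreesWith i R) (dup Y x) (λ z m → there (remove⊆ x (dom Y) z (fv-agreesWith i R z m)))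
      sound complete
    where
    R : List ℕ
    R = remove x (dom Y)
    sound : ∀ s → sat s (agreesWith i R) → s ∈T dup Y x
    sound s h with agreesWith-sound R s e (remove⊆ x (dom Y)) h
    ... | r , r∈ , a = update r x (s x) , (r , r∈ , s x , λ _ → refl) , agreeOnDom
      where
      agreeOnDom : agree (x ∷ dom Y) (update r x (s x)) s
      agreeOnDom z m with z ≟ x
      ... | yes refl = update-same r x (s x)
      ... | no  z≢x with m
      ...   | here z≡x = ⊥-elim (z≢x z≡x)
      ...   | there k  = trans (update-other r x (s x) z≢x) (a z (∈-remove⁺ (dom Y) k z≢x))
    complete : ∀ s → s ∈T dup Y x → sat s (agreesWith i R)
    complete s (s' , (s₀ , s₀∈ , d , s'≡) , a) =
      agreesWith-complete R e s₀∈ λ z k →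
        let (z∈Y , z≢x) = ∈-remove⁻ (dom Y) k in
        trans (sym (update-other s₀ x d z≢x)) (trans (sym (s'≡ z)) (a z (there z∈Y)))

  _≼[_]_ : Team D → List ℕ → Team D → Set
  X ≼[ V ] Y = ∀ s → s ∈T X → Σ (ℕ → D) λ s' → s' ∈T Y × agree V s s'

  -- X and Y are V-similar: V lies in both domains and X ↾ V = Y ↾ V.
  record _≈[_]_ (X : Team D) (V : List ℕ) (Y : Team D) : Set where
    field
      domˡ   : V ⊆ dom X
      domʳ   : V ⊆ dom Y
      coverˡ : X ≼[ V ] Y
      coverʳ : Y ≼[ V ] X
  open _≈[_]_

  ≈-sym : ∀ {X Y V} → X ≈[ V ] Y → Y ≈[ V ] X
  ≈-sym X≈Y = record { domˡ = domʳ X≈Y ; domʳ = domˡ X≈Y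
                     ; coverˡ = coverʳ X≈Y ; coverʳ = coverˡ X≈Y }

  restrict-≈ : ∀ (X : Team D) {V} → V ⊆ dom X → X ≈[ V ] (X ↾ V)
  restrict-≈ X V⊆X = record
    { domˡ   = V⊆X
    ; domʳ   = ⊆-refl
    ; coverˡ = λ s s∈ → s , (s , s∈ , λ _ _ → refl) , λ _ _ → refl
    ; coverʳ = λ { s (s' , s'∈ , a) → s' , s'∈ , agree-sym a }
    }

  dup-≼ : ∀ {V} (X Y : Team D) x → V ⊆ dom X → X ≼[ V ] Y → dup X x ≼[ x ∷ V ] dup Y x
  dup-≼ X Y x V⊆X X≼Y s (s' , (s₀ , s₀∈ , d , s'≡) , a) with X≼Y s₀ s₀∈
  ... | s₁ , s₁∈ , a₁ =
    update s₁ x (s x) , (update s₁ x (s x) , (s₁ , s₁∈ , s x , λ _ → refl) , λ _ _ → refl) ,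
    agreeOnx∷V
    where
    agreeOnx∷V : agree (x ∷ _) s (update s₁ x (s x))
    agreeOnx∷V z (here refl) = sym (update-same s₁ z (s z))
    agreeOnx∷V z (there k) with z ≟ x
    ... | yes refl = sym (update-same s₁ z (s z))
    ... | no  z≢x  = trans (sym (a z (there (V⊆X z k))))
                    (trans (s'≡ z) (trans (update-other s₀ x d z≢x)
                    (trans (a₁ z k) (sym (update-other s₁ x (s x) z≢x)))))

  dup-≈ : ∀ {X Y V} x → X ≈[ V ] Y → dup X x ≈[ x ∷ V ] dup Y x
  dup-≈ {X} {Y} x X≈Y = record
    { domˡ   = λ { z (here e) → here e ; z (there m) → there (domˡ X≈Y z m) }
    ; domʳ   = λ { z (here e) → here e ; z (there m) → there (domʳ X≈Y z m) }
    ; coverˡ = dup-≼ X Y x (domˡ X≈Y) (coverˡ X≈Y)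
    ; coverʳ = dup-≼ Y X x (domʳ X≈Y) (coverʳ X≈Y)
    }

  -- Disjunction.  A subteam A of X is mirrored in Y by the subteam A' of those
  -- s ∈ Y agreeing on V with some member of A; A' is definable, hence in 𝒢.
  record Mirror (V : List ℕ) (Y A : Team D) : Set₁ where
    field
      A'     : Team D
      A'∈G   : (G ∈G) A'
      domA'  : sameDom (dom A') (dom Y)
      A'⊆Y   : ∀ s → s ∈T A' → s ∈T Y
      intoA' : ∀ s → s ∈T Y → (Σ (ℕ → D) λ r → r ∈T A × agree V r s) → s ∈T A'
      A≈A'   : A ≈[ V ] A'

  mirror : ∀ {V} {X Y A : Team D} → X ≈[ V ] Y → (G ∈G) Y → (G ∈G) A →
           sameDom (dom A) (dom X) → (∀ s → s ∈T A → s ∈T X) → Mirror V Y A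
  mirror {V} {Y = Y} {A} X≈Y (iY , eY) (iA , eA) domA A⊆X = record
    { A'     = A'
    ; A'∈G   = closed G ψ (dom Y) fvψ
    ; domA'  = λ z → mk⇔ (λ m → m) (λ m → m)
    ; A'⊆Y   = A'⊆Y
    ; intoA' = intoA'
    ; A≈A'   = record
      { domˡ   = λ z m → from (domA z) (domˡ X≈Y z m)
      ; domʳ   = domʳ X≈Y
      ; coverˡ = λ r r∈ → let (s , s∈ , a) = coverˡ X≈Y r (A⊆X r r∈) in
                          s , intoA' s s∈ (r , r∈ , a) , a
      ; coverʳ = A'≼A
      }
    }
    where
    ψ : Formula
    ψ = andF (agreesWith iY (dom Y)) (agreesWith iA V)
    A' : Team D
    A' = ⟦_⟧_ M (team G) ψ (dom Y)
    fvψ : fvFO ψ ⊆ dom Y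
    fvψ z m with ∈-++⁻ (fvFO (agreesWith iY (dom Y))) m
    ... | inj₁ k = fv-agreesWith iY (dom Y) z k
    ... | inj₂ k = domʳ X≈Y z (fv-agreesWith iA V z k)
    A'⊆Y : ∀ s → s ∈T A' → s ∈T Y
    A'⊆Y s (s' , (inY , _) , a) with agreesWith-sound (dom Y) s' eY ⊆-refl inY
    ... | r , r∈ , ar = ∈T-agree Y r∈ (λ z m → trans (ar z m) (a z m))
    intoA' : ∀ s → s ∈T Y → (Σ (ℕ → D) λ r → r ∈T A × agree V r s) → s ∈T A'
    intoA' s s∈ (r , r∈ , ar) =
      s , (agreesWith-complete (dom Y) eY s∈ (λ _ _ → refl) , agreesWith-complete V eA r∈ ar) ,
      λ _ _ → refl
    A'≼A : A' ≼[ V ] A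
    A'≼A s (s' , (_ , inA) , a) with agreesWith-sound V s' eA (λ z m → from (domA z) (domˡ X≈Y z m)) inA
    ... | r , r∈ , ar = r , r∈ , λ z m → trans (sym (a z (domʳ X≈Y z m))) (sym (ar z m))

  -- Existential quantification.  An x-extension X' of X is mirrored by the
  -- x-extension Y' of Y consisting of the s with s ↾ (dom Y ∖ x) ∈ Y that
  -- agree on x ∷ V with some member of X'.
  record ExtMirror (V : List ℕ) (x : ℕ) (Y X' : Team D) : Set₁ where
    field
      Y'      : Team D
      Y'∈G    : (G ∈G) Y'
      domY'   : sameDom (dom Y') (x ∷ dom Y)
      extends : (Y' ↾ remove x (dom Y)) ≐ (Y ↾ remove x (dom Y))
      X'≈Y'   : X' ≈[ x ∷ V ] Y'

  extMirror : ∀ {V} x {X Y X' : Team D} → X ≈[ V ] Y → (G ∈G) Y → (G ∈G) X' →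
              sameDom (dom X') (x ∷ dom X) →
              (X' ↾ remove x (dom X)) ≐ (X ↾ remove x (dom X)) → ExtMirror V x Y X'
  extMirror {V} x {X} {Y} {X'} X≈Y (iY , eY) (i' , e') domX' (_ , X'extends) = record
    { Y'      = Y'
    ; Y'∈G    = closed G ψ (x ∷ dom Y) fvψ
    ; domY'   = λ z → mk⇔ (λ m → m) (λ m → m)
    ; extends = (λ z → mk⇔ (λ m → m) (λ m → m)) , λ s → mk⇔ (restrictTo s) (restrictFrom s)
    ; X'≈Y'   = record { domˡ = x∷V⊆X' ; domʳ = x∷V⊆Y' ; coverˡ = X'≼Y' ; coverʳ = Y'≼X' }
    }
    where
    RY : List ℕ
    RY = remove x (dom Y)
    ψ : Formula
    ψ = andF (agreesWith iY RY) (agreesWith i' (x ∷ V))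
    Y' : Team D
    Y' = ⟦_⟧_ M (team G) ψ (x ∷ dom Y)
    x∷V⊆Y' : (x ∷ V) ⊆ (x ∷ dom Y)
    x∷V⊆Y' z (here e)  = here e
    x∷V⊆Y' z (there m) = there (domʳ X≈Y z m)
    x∷V⊆X' : (x ∷ V) ⊆ dom X'
    x∷V⊆X' z (here e)  = from (domX' z) (here e)
    x∷V⊆X' z (there m) = from (domX' z) (there (domˡ X≈Y z m))
    fvψ : fvFO ψ ⊆ (x ∷ dom Y)
    fvψ z m with ∈-++⁻ (fvFO (agreesWith iY RY)) m
    ... | inj₁ k = there (remove⊆ x (dom Y) z (fv-agreesWith iY RY z k))
    ... | inj₂ k = x∷V⊆Y' z (fv-agreesWith i' (x ∷ V) z k)
    agreeUpdate : ∀ s' q → (∀ z → z ∈ V → ¬ z ≡ x → s' z ≡ q z) →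
                  agree (x ∷ V) q (update s' x (q x))
    agreeUpdate s' q c z (here refl) = sym (update-same s' z (q z))
    agreeUpdate s' q c z (there m) with z ≟ x
    ... | yes refl = sym (update-same s' z (q z))
    ... | no  z≢x  = trans (sym (c z m z≢x)) (sym (update-other s' x (q x) z≢x))
    intoY' : ∀ s' q → s' ∈T Y → q ∈T X' → (∀ z → z ∈ V → ¬ z ≡ x → s' z ≡ q z) →
             update s' x (q x) ∈T Y'
    intoY' s' q s'∈ q∈ c =
      update s' x (q x) ,
      (agreesWith-complete RY eY s'∈
         (λ z m → sym (update-other s' x (q x) (proj₂ (∈-remove⁻ (dom Y) m)))) ,
       agreesWith-complete (x ∷ V) e' q∈ (agreeUpdate s' q c)) ,
      λ _ _ → refl
    restrictTo : ∀ s → s ∈T (Y' ↾ RY) → s ∈T (Y ↾ RY)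
    restrictTo s (s' , (t , (inY , _) , at) , a)
      with agreesWith-sound RY t eY (remove⊆ x (dom Y)) inY
    ... | r , r∈ , ar =
      r , r∈ , λ z m → trans (ar z m) (trans (at z (there (remove⊆ x (dom Y) z m))) (a z m))
    restrictFrom : ∀ s → s ∈T (Y ↾ RY) → s ∈T (Y' ↾ RY)
    restrictFrom s (s' , s'∈ , a) with coverʳ X≈Y s' s'∈
    ... | r , r∈ , ar with from (X'extends r) (r , r∈ , λ _ _ → refl)
    ...   | q , q∈ , aq =
      update s' x (q x) , intoY' s' q s'∈ q∈ agreeOffx ,
      λ z m → trans (update-other s' x (q x) (proj₂ (∈-remove⁻ (dom Y) m))) (a z m)
      where
      agreeOffx : ∀ z → z ∈ V → ¬ z ≡ x → s' z ≡ q z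
      agreeOffx z m z≢x = trans (ar z m) (sym (aq z (∈-remove⁺ (dom X) (domˡ X≈Y z m) z≢x)))
    X'≼Y' : X' ≼[ x ∷ V ] Y'
    X'≼Y' q q∈ with to (X'extends q) (q , q∈ , λ _ _ → refl)
    ... | r , r∈ , ar with coverˡ X≈Y r r∈
    ...   | s' , s'∈ , as = update s' x (q x) , intoY' s' q s'∈ q∈ agreeOffx , agreeUpdate s' q agreeOffx
      where
      agreeOffx : ∀ z → z ∈ V → ¬ z ≡ x → s' z ≡ q z
      agreeOffx z m z≢x = trans (sym (as z m)) (ar z (∈-remove⁺ (dom X) (domˡ X≈Y z m) z≢x))
    Y'≼X' : Y' ≼[ x ∷ V ] X'
    Y'≼X' t (t' , (_ , inX') , at) with agreesWith-sound (x ∷ V) t' e' x∷V⊆X' inX'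
    ... | q , q∈ , aq = q , q∈ , λ z m → trans (sym (at z (x∷V⊆Y' z m))) (sym (aq z m))

  indep-transfer : ∀ t₁ t₂ t₃ {V} {X Y : Team D} → Free (indep t₁ t₂ t₃) ⊆ V →
                   X ≈[ V ] Y → Sat G X (indep t₁ t₂ t₃) → Sat G Y (indep t₁ t₂ t₃)
  indep-transfer t₁ t₂ t₃ {V} {Y = Y} fv X≈Y h = atY
    where
    ev : ∀ ts {p q} → agree V p q → fvTL ts ⊆ V → evalTL M ⊥-elim p ts ≡ evalTL M ⊥-elim q ts
    ev ts {p} {q} a ts⊆V = evalTL-agree ts p q (agree-⊆ a ts⊆V)
    fv₁ : fvTL t₁ ⊆ V
    fv₁ = ++⊆ˡ fv
    fv₂ : fvTL t₂ ⊆ V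
    fv₂ = ++⊆ˡ (++⊆ʳ {fvTL t₁} fv)
    fv₃ : fvTL t₃ ⊆ V
    fv₃ = ++⊆ʳ {fvTL t₂} (++⊆ʳ {fvTL t₁} fv)
    fv₁+ : ∀ {u} → fvTL u ⊆ V → fvTL (t₁ ++ u) ⊆ V
    fv₁+ {u} fvu z m with ∈-++⁻ (fvTL t₁) (subst (z ∈_) (fvTL-++ t₁ u) m)
    ... | inj₁ k = fv₁ z k
    ... | inj₂ k = fvu z k
    -- pull s, s' back to X, combine there, and push the witness forward to Y
    atY : Sat G Y (indep t₁ t₂ t₃)
    atY s s' s∈ s'∈ s≡s' with coverʳ X≈Y s s∈ | coverʳ X≈Y s' s'∈
    ... | r , r∈ , a | r' , r'∈ , a'
      with lower (h r r' r∈ r'∈ (trans (sym (ev t₁ a fv₁)) (trans s≡s' (ev t₁ a' fv₁))))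
    ...   | r'' , r''∈ , e₂ , e₃ with coverˡ X≈Y r'' r''∈
    ...     | s'' , s''∈ , a'' =
      lift (s'' , s''∈ ,
            trans (sym (ev (t₁ ++ t₂) a'' (fv₁+ fv₂))) (trans e₂ (sym (ev (t₁ ++ t₂) a (fv₁+ fv₂)))) ,
            trans (sym (ev (t₁ ++ t₃) a'' (fv₁+ fv₃))) (trans e₃ (sym (ev (t₁ ++ t₃) a' (fv₁+ fv₃)))))

  transfer : ∀ φ {V} {X Y : Team D} → Free φ ⊆ V → X ≈[ V ] Y → (G ∈G) Y →
             Sat G X φ → Sat G Y φ
  transfer (eqL t u) fv X≈Y Y∈G h s s∈ with coverʳ X≈Y s s∈
  ... | r , r∈ , a =
    lift (trans (evalT-agree t s r (agree-⊆ a (++⊆ˡ fv)))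
         (trans (lower (h r r∈)) (sym (evalT-agree u s r (agree-⊆ a (++⊆ʳ {fvT t} fv))))))
  transfer (neqL t u) fv X≈Y Y∈G h s s∈ with coverʳ X≈Y s s∈
  ... | r , r∈ , a =
    lift (λ eq → lower (h r r∈) (trans (sym (evalT-agree t s r (agree-⊆ a (++⊆ˡ fv))))
                                (trans eq (evalT-agree u s r (agree-⊆ a (++⊆ʳ {fvT t} fv))))))
  transfer (relL R ts) fv X≈Y Y∈G h s s∈ with coverʳ X≈Y s s∈
  ... | r , r∈ , a = lift (subst (rel R) (sym (evalTs-agree ts s r (agree-⊆ a fv))) (lower (h r r∈)))
  transfer (nrelL R ts) fv X≈Y Y∈G h s s∈ with coverʳ X≈Y s s∈
  ... | r , r∈ , a = lift (λ k → lower (h r r∈) (subst (rel R) (evalTs-agree ts s r (agree-⊆ a fv)) k))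
  transfer (indep t₁ t₂ t₃) fv X≈Y Y∈G h = indep-transfer t₁ t₂ t₃ fv X≈Y h
  transfer (andL φ ψ) fv X≈Y Y∈G (h₁ , h₂) =
    transfer φ (++⊆ˡ fv) X≈Y Y∈G h₁ , transfer ψ (++⊆ʳ {Free φ} fv) X≈Y Y∈G h₂
  transfer (orL φ ψ) {Y = Y} fv X≈Y Y∈G (Y₁ , Z₁ , (Y₁∈G , Z₁∈G) , (domY₁ , domZ₁ , split) , h₁ , h₂) =
    P.A' , Q.A' , (P.A'∈G , Q.A'∈G) ,
    (P.domA' , Q.domA' , λ s → mk⇔ (splitY s) λ { (inj₁ m) → P.A'⊆Y s m ; (inj₂ m) → Q.A'⊆Y s m }) ,
    transfer φ (++⊆ˡ fv) P.A≈A' P.A'∈G h₁ ,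
    transfer ψ (++⊆ʳ {Free φ} fv) Q.A≈A' Q.A'∈G h₂
    where
    module P = Mirror (mirror X≈Y Y∈G Y₁∈G domY₁ (λ s m → from (split s) (inj₁ m)))
    module Q = Mirror (mirror X≈Y Y∈G Z₁∈G domZ₁ (λ s m → from (split s) (inj₂ m)))
    splitY : ∀ s → s ∈T Y → (s ∈T P.A') ⊎ (s ∈T Q.A')
    splitY s s∈ with coverʳ X≈Y s s∈
    ... | r , r∈ , a with to (split r) r∈
    ...   | inj₁ k = inj₁ (P.intoA' s s∈ (r , k , agree-sym a))
    ...   | inj₂ k = inj₂ (Q.intoA' s s∈ (r , k , agree-sym a))
  transfer (exL x φ) {V} fv X≈Y Y∈G (X' , X'∈G , domX' , X'extends , h) =
    E.Y' , E.Y'∈G , E.domY' , E.extends ,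
    transfer φ (remove⊆⇒⊆∷ x (Free φ) V fv) E.X'≈Y' E.Y'∈G h
    where module E = ExtMirror (extMirror x X≈Y Y∈G X'∈G domX' X'extends)
  transfer (allL x φ) {V} {Y = Y} fv X≈Y Y∈G h =
    transfer φ (remove⊆⇒⊆∷ x (Free φ) V fv) (dup-≈ x X≈Y) (dup∈G Y x Y∈G) h

mainTheorem6 : {σ : Signature} (M : Structure σ) (G : GeneralModel M)
    (X : Team (Structure.D M)) → (G ∈G) X →
    (φ : IL σ) → (∀ (x : ℕ) → x ∈ Free φ → x ∈ dom X) →
    (G ∈G) (X ↾ Free φ) × (Sat G X φ ⇔ Sat G (X ↾ Free φ) φ)
mainTheorem6 M G X X∈G φ fv =
  restriction∈G ,
  mk⇔ (transfer φ ⊆-refl similar restriction∈G) (transfer φ ⊆-refl (≈-sym similar) X∈G)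
  where
  open Locality M G
  restriction∈G : (G ∈G) (X ↾ Free φ)
  restriction∈G = restrict∈G X (Free φ) X∈G fv
  similar : X ≈[ Free φ ] (X ↾ Free φ)
  similar = restrict-≈ X fv
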